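{- Consider a logical system $\vdash'$ in the language $\mathcal{L}$ satisfying the axioms of classical logic and (MP). The following are equivalent: (1) $\vdash'$ satisfies (L1)–(L4) and (C); (2) $\vdash'$ satisfies (L1)–(L3) and the rule (DWC$_2$). The same holds replacing (C) and (DWC$_2$) with their weaker versions (wC) and (wDWC$_2$).
   Context: $\mathcal L$ is the language of classical propositional logic $\{\land,\lor,\to,0,1\}$ expanded with a binary connective $\mathbin{\Box\!\!\rightarrow}$. The axioms are: (L1) $\varphi\mathbin{\Box\!\!\rightarrow}\varphi$; (L2) $((\varphi\mathbin{\Box\!\!\rightarrow}\psi)\wedge(\psi\mathbin{\Box\!\!\rightarrow}\varphi))\to((\varphi\mathbin{\Box\!\!\rightarrow}\gamma)\leftrightarrow(\psi\mathbin{\Box\!\!\rightarrow}\gamma))$; (L3) $((\varphi\vee\psi)\mathbin{\Box\!\!\rightarrow}\varphi)\vee((\varphi\vee\psi)\mathbin{\Box\!\!\rightarrow}\psi)\vee(((\varphi\vee\psi)\mathbin{\Box\!\!\rightarrow}\gamma)\leftrightarrow((\varphi\mathbin{\Box\!\!\rightarrow}\gamma)\wedge(\psi\mathbin{\Box\!\!\rightarrow}\gamma)))$; (L4) $(\varphi\mathbin{\Box\!\!\rightarrow}(\psi\land\gamma))\leftrightarrow((\varphi\mathbin{\Box\!\!\rightarrow}\psi)\land(\varphi\mathbin{\Box\!\!\rightarrow}\gamma))$. (MP) is $\varphi,\varphi\to\psi\vdash'\psi$. The rules are: (C) $\varphi\to\psi\vdash'(\gamma\mathbin{\Box\!\!\rightarrow}\varphi)\to(\gamma\mathbin{\Box\!\!\rightarrow}\psi)$;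 (wC) if $\vdash'\varphi\to\psi$ then $\vdash'(\gamma\mathbin{\Box\!\!\rightarrow}\varphi)\to(\gamma\mathbin{\Box\!\!\rightarrow}\psi)$; (DWC$_2$) $(\varphi_1\wedge\varphi_2)\to\psi\vdash'((\gamma\mathbin{\Box\!\!\rightarrow}\varphi_1)\wedge(\gamma\mathbin{\Box\!\!\rightarrow}\varphi_2))\to(\gamma\mathbin{\Box\!\!\rightarrow}\psi)$; (wDWC$_2$) if $\vdash'(\varphi_1\wedge\varphi_2)\to\psi$ then $\vdash'((\gamma\mathbin{\Box\!\!\rightarrow}\varphi_1)\wedge(\gamma\mathbin{\Box\!\!\rightarrow}\varphi_2))\to(\gamma\mathbin{\Box\!\!\rightarrow}\psi)$. -}

module Defs where

open import Data.Nat using (ℕ)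
open import Data.Bool using (Bool; true; false; _∧_; _∨_; not)
open import Data.Empty using (⊥)
open import Data.Sum using (_⊎_)
open import Data.Product using (_×_)
open import Relation.Binary.PropositionalEquality using (_≡_)
open import Function.Bundles using (_⇔_)

infixr 6 _∧'_
infixr 5 _∨'_
infixr 4 _⇒_ _⇔'_
infix  7 _□→_

data Formula : Set where
  var   : ℕ → Formula
  _∧'_  : Formula → Formula → Formula
  _∨'_  : Formula → Formula → Formula
  _⇒_   : Formula → Formula → Formula
  ⊥'    : Formula
  ⊤'    : Formula
  _□→_  : Formula → Formula → Formula

_⇔'_ : Formula → Formula → Formula
φ ⇔' ψ = (φ ⇒ ψ) ∧' (ψ ⇒ φ)

-- Classical (Boolean) evaluation: variables get values via v, and every
-- □→-formula is treated as an atom whose value is given by w.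
_⇒ᵇ_ : Bool → Bool → Bool
a ⇒ᵇ b = not a ∨ b

eval : (ℕ → Bool) → (Formula → Formula → Bool) → Formula → Bool
eval v w (var n)   = v n
eval v w (φ ∧' ψ)  = eval v w φ ∧ eval v w ψ
eval v w (φ ∨' ψ)  = eval v w φ ∨ eval v w ψ
eval v w (φ ⇒ ψ)   = eval v w φ ⇒ᵇ eval v w ψ
eval v w ⊥'        = false
eval v w ⊤'        = true
eval v w (φ □→ ψ)  = w φ ψ

Tautology : Formula → Set
Tautology φ = ∀ v w → eval v w φ ≡ true

Premises : Set₁
Premises = Formula → Set

∅ : Premises
∅ _ = ⊥

⟦_⟧ : Formula → Premises
⟦ φ ⟧ ψ = ψ ≡ φ

⟦_,_⟧ : Formula → Formula → Premises
⟦ φ₁ , φ₂ ⟧ ψ = (ψ ≡ φ₁) ⊎ (ψ ≡ φ₂)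

record LogicalSystem : Set₁ where
  field
    _⊢_    : Premises → Formula → Set
    reflex : ∀ {Γ φ} → Γ φ → Γ ⊢ φ
    monot  : ∀ {Γ Δ φ} → (∀ ψ → Γ ψ → Δ ψ) → Γ ⊢ φ → Δ ⊢ φ
    cut    : ∀ {Γ Δ φ} → (∀ ψ → Δ ψ → Γ ⊢ ψ) → Δ ⊢ φ → Γ ⊢ φ

module _ (S : LogicalSystem) where
  open LogicalSystem S

  Thm : Formula → Set
  Thm φ = ∅ ⊢ φ

  Classical : Set
  Classical = ∀ φ → Tautology φ → Thm φ

  MP : Set
  MP = ∀ φ ψ → ⟦ φ , φ ⇒ ψ ⟧ ⊢ ψ

  L1 : Set
  L1 = ∀ φ → Thm (φ □→ φ)

  L2 : Set
  L2 = ∀ φ ψ γ → Thm (((φ □→ ψ) ∧' (ψ □→ φ)) ⇒ ((φ □→ γ) ⇔' (ψ □→ γ)))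

  L3 : Set
  L3 = ∀ φ ψ γ → Thm (((φ ∨' ψ) □→ φ) ∨' ((φ ∨' ψ) □→ ψ)
                       ∨' (((φ ∨' ψ) □→ γ) ⇔' ((φ □→ γ) ∧' (ψ □→ γ))))

  L4 : Set
  L4 = ∀ φ ψ γ → Thm ((φ □→ (ψ ∧' γ)) ⇔' ((φ □→ ψ) ∧' (φ □→ γ)))

  RuleC : Set
  RuleC = ∀ φ ψ γ → ⟦ φ ⇒ ψ ⟧ ⊢ ((γ □→ φ) ⇒ (γ □→ ψ))

  RulewC : Set
  RulewC = ∀ φ ψ γ → Thm (φ ⇒ ψ) → Thm ((γ □→ φ) ⇒ (γ □→ ψ))

  RuleDWC₂ : Set
  RuleDWC₂ = ∀ φ₁ φ₂ ψ γ →
    ⟦ (φ₁ ∧' φ₂) ⇒ ψ ⟧ ⊢ (((γ □→ φ₁) ∧' (γ □→ φ₂)) ⇒ (γ □→ ψ))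

  RulewDWC₂ : Set
  RulewDWC₂ = ∀ φ₁ φ₂ ψ γ → Thm ((φ₁ ∧' φ₂) ⇒ ψ) →
    Thm (((γ □→ φ₁) ∧' (γ □→ φ₂)) ⇒ (γ □→ ψ))

{-# OPTIONS --safe #-}
-- Under (L4), (DWC₂) is (C) for the consequent φ₁ ∧ φ₂ preceded by the
-- right-to-left half of (L4), and (C) is (DWC₂) with φ₁ = φ₂.  Moreover (L4)
-- is itself derivable from (wDWC₂): apply it to ψ ∧ χ → ψ ∧ χ for one
-- direction, and to ψ ∧ χ → ψ, ψ ∧ χ → χ (through the derived (wC)) for the
-- other.
module Submission where

open import Defs
open import Data.Bool using (true; false)
open import Data.Bool.Properties using (∨-inverseˡ)
open import Data.Product using (_×_; _,_)
open import Data.Sum using (inj₁; inj₂)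
open import Function.Bundles using (_⇔_; mk⇔)
open import Relation.Binary.PropositionalEquality using (refl)

private
  variable
    Γ : Premises
    A B C φ ψ γ : Formula

taut-⇒-refl : ∀ A → Tautology (A ⇒ A)
taut-⇒-refl A v w = ∨-inverseˡ (eval v w A)

taut-∧-elimˡ : ∀ A B → Tautology ((A ∧' B) ⇒ A)
taut-∧-elimˡ A B v w with eval v w A | eval v w B
... | true  | true  = refl
... | true  | false = refl
... | false | _     = refl

taut-∧-elimʳ : ∀ A B → Tautology ((A ∧' B) ⇒ B)
taut-∧-elimʳ A B v w with eval v w A | eval v w B
... | true  | true  = refl
... | true  | false = refl
... | false | _     = refl

taut-∧-intro : ∀ A B → Tautology (A ⇒ (B ⇒ (A ∧' B)))
taut-∧-intro A B v w with eval v w A | eval v w B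
... | true  | true  = refl
... | true  | false = refl
... | false | _     = refl

taut-⇒-trans : ∀ A B C → Tautology ((A ⇒ B) ⇒ ((B ⇒ C) ⇒ (A ⇒ C)))
taut-⇒-trans A B C v w with eval v w A | eval v w B | eval v w C
... | true  | true  | true  = refl
... | true  | true  | false = refl
... | true  | false | _     = refl
... | false | true  | true  = refl
... | false | true  | false = refl
... | false | false | _     = refl

taut-⇒-∧ : ∀ A B C → Tautology ((A ⇒ B) ⇒ ((A ⇒ C) ⇒ (A ⇒ (B ∧' C))))
taut-⇒-∧ A B C v w with eval v w A | eval v w B | eval v w C
... | true  | true  | true  = refl
... | true  | true  | false = refl
... | true  | false | _     = refl
... | false | _     | _     = refl

module Consequence (S : LogicalSystem) where
  open LogicalSystem S

  weaken : Thm S φ → Γ ⊢ φ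
  weaken = monot (λ _ ())

  cut-⟦⟧ : Γ ⊢ φ → ⟦ φ ⟧ ⊢ ψ → Γ ⊢ ψ
  cut-⟦⟧ p = cut λ { _ refl → p }

  cut-⟦,⟧ : Γ ⊢ φ → Γ ⊢ ψ → ⟦_,_⟧ φ ψ ⊢ γ → Γ ⊢ γ
  cut-⟦,⟧ p q = cut λ { _ (inj₁ refl) → p ; _ (inj₂ refl) → q }

module ClassicalReasoning (S : LogicalSystem) (classical : Classical S) (modus-ponens : MP S) where
  open LogicalSystem S
  open Consequence S public

  tautology : Tautology φ → Γ ⊢ φ
  tautology {φ} t = weaken (classical φ t)

  mp : Γ ⊢ A → Γ ⊢ (A ⇒ B) → Γ ⊢ B
  mp {A = A} {B} p q = cut-⟦,⟧ p q (modus-ponens A B)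

  mp₂ : Tautology (A ⇒ (B ⇒ C)) → Γ ⊢ A → Γ ⊢ B → Γ ⊢ C
  mp₂ t p q = mp q (mp p (tautology t))

  ∧-intro : Γ ⊢ A → Γ ⊢ B → Γ ⊢ (A ∧' B)
  ∧-intro {A = A} {B} = mp₂ (taut-∧-intro A B)

  ∧-elimʳ : Γ ⊢ (A ∧' B) → Γ ⊢ B
  ∧-elimʳ {A = A} {B} p = mp p (tautology (taut-∧-elimʳ A B))

  ⇒-trans : Γ ⊢ (A ⇒ B) → Γ ⊢ (B ⇒ C) → Γ ⊢ (A ⇒ C)
  ⇒-trans {A = A} {B} {C} = mp₂ (taut-⇒-trans A B C)

  ⇒-∧ : Γ ⊢ (A ⇒ B) → Γ ⊢ (A ⇒ C) → Γ ⊢ (A ⇒ (B ∧' C))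
  ⇒-∧ {A = A} {B} {C} = mp₂ (taut-⇒-∧ A B C)

  ∧-contract : Γ ⊢ ((A ∧' A) ⇒ B) → Γ ⊢ (A ⇒ B)
  ∧-contract {A = A} = ⇒-trans (⇒-∧ A⇒A A⇒A)
    where A⇒A = tautology (taut-⇒-refl A)

  ∧-duplicate : Γ ⊢ (A ⇒ B) → Γ ⊢ ((A ∧' A) ⇒ B)
  ∧-duplicate {A = A} = ⇒-trans (tautology (taut-∧-elimˡ A A))

module Counterfactual (S : LogicalSystem) (classical : Classical S) (modus-ponens : MP S) where
  open LogicalSystem S
  open ClassicalReasoning S classical modus-ponens

  L4-fold : L4 S → ∀ φ₁ φ₂ γ → Γ ⊢ (((γ □→ φ₁) ∧' (γ □→ φ₂)) ⇒ (γ □→ (φ₁ ∧' φ₂)))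
  L4-fold l4 φ₁ φ₂ γ = ∧-elimʳ (weaken (l4 γ φ₁ φ₂))

  C⇒DWC₂ : L4 S → RuleC S → RuleDWC₂ S
  C⇒DWC₂ l4 c φ₁ φ₂ ψ γ = ⇒-trans (L4-fold l4 φ₁ φ₂ γ) (c (φ₁ ∧' φ₂) ψ γ)

  wC⇒wDWC₂ : L4 S → RulewC S → RulewDWC₂ S
  wC⇒wDWC₂ l4 c φ₁ φ₂ ψ γ h = ⇒-trans (L4-fold l4 φ₁ φ₂ γ) (c (φ₁ ∧' φ₂) ψ γ h)

  DWC₂⇒C : RuleDWC₂ S → RuleC S
  DWC₂⇒C d φ ψ γ = ∧-contract (cut-⟦⟧ (∧-duplicate (reflex refl)) (d φ φ ψ γ))

  DWC₂⇒wDWC₂ : RuleDWC₂ S → RulewDWC₂ S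
  DWC₂⇒wDWC₂ d φ₁ φ₂ ψ γ h = cut-⟦⟧ h (d φ₁ φ₂ ψ γ)

  wDWC₂⇒wC : RulewDWC₂ S → RulewC S
  wDWC₂⇒wC d φ ψ γ h = ∧-contract (d φ φ ψ γ (∧-duplicate h))

  wDWC₂⇒L4 : RulewDWC₂ S → L4 S
  wDWC₂⇒L4 d φ ψ χ = ∧-intro split fold
    where
      wc = wDWC₂⇒wC d
      split = ⇒-∧ (wc (ψ ∧' χ) ψ φ (tautology (taut-∧-elimˡ ψ χ)))
                  (wc (ψ ∧' χ) χ φ (tautology (taut-∧-elimʳ ψ χ)))
      fold = d ψ χ (ψ ∧' χ) φ (tautology (taut-⇒-refl (ψ ∧' χ)))

theorem3p6 : (S : LogicalSystem) → Classical S → MP S →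
      ((L1 S × L2 S × L3 S × L4 S × RuleC S) ⇔ (L1 S × L2 S × L3 S × RuleDWC₂ S))
    × ((L1 S × L2 S × L3 S × L4 S × RulewC S) ⇔ (L1 S × L2 S × L3 S × RulewDWC₂ S))
theorem3p6 S classical modus-ponens =
    mk⇔ (λ (l1 , l2 , l3 , l4 , c) → l1 , l2 , l3 , C⇒DWC₂ l4 c)
        (λ (l1 , l2 , l3 , d) → l1 , l2 , l3 , wDWC₂⇒L4 (DWC₂⇒wDWC₂ d) , DWC₂⇒C d)
  , mk⇔ (λ (l1 , l2 , l3 , l4 , c) → l1 , l2 , l3 , wC⇒wDWC₂ l4 c)
        (λ (l1 , l2 , l3 , d) → l1 , l2 , l3 , wDWC₂⇒L4 d , wDWC₂⇒wC d)
  where open Counterfactual S classical modus-ponens
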